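{- For $n,m\geq1$, $\vec{v}\in\widehat{\mathbb{N}}^n$, $\vec{w}\in\widehat{\mathbb{N}}^m$ define $\vec{v}\nearrow\vec{w}:=(v_1,\ldots,v_n,\,n\triangleright\vec{w})$ and $\vec{v}\nwarrow\vec{w}:=(v_1,\ldots,v_n,\,w_1+n,\ldots,w_m+n)$. Then these are elements of $\widehat{\mathbb{N}}^{n+m}$, and the two operations $\nearrow,\nwarrow$ are associative and satisfy $(\vec u\nearrow\vec v)\nwarrow\vec w=\vec u\nearrow(\vec v\nwarrow\vec w)$; thus they make $\bigcup_{n\geq1}\widehat{\mathbb{N}}^n$ an associative $L$-monoid and (by bilinear extension) $\bigoplus_{n\ge1}K\widehat{\mathbb{N}}^n$ an associative $L$-algebra. The map $\mathrm{name}$ is a morphism of $L$-monoids (and, extended linearly, of $L$-algebras): $\mathrm{name}(\pi\nearrow\tau)=\mathrm{name}(\pi)\nearrow\mathrm{name}(\tau)$ and $\mathrm{name}(\pi\nwarrow\tau)=\mathrm{name}(\pi)\nwarrow\mathrm{name}(\tau)$ for trees $\pi,\tau$. Moreover $M(\vec{v}\nearrow\vec{w})=M(\vec{v})M(\vec{w})$, and $M(\vec{v}\nwarrow\vec{w})=(-1)^mM(\vec{v})$ if $\vec{w}=(1,2,\ldots,m)$, while $M(\vec{v}\nwarrow\vec{w})=0$ otherwise.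
   Context: $K$ is a field of characteristic zero. $Y_n$ is the set of planar rooted binary trees with $n$ internal vertices ($n+1$ leaves), identified with complete parenthesizations of $x_1\cdots x_{n+1}$ (each product of two factors $A,B$ written $(AB)$). The name of $\tau\in Y_n$ ($n\ge1$) is $\mathrm{name}(\tau)=(v_1,\ldots,v_n)$: $v_i=i$ if $x_i$ is immediately preceded by at least one left parenthesis; otherwise $x_i$ is immediately followed by a nonempty block of right parentheses and $v_i=j$, where $x_j$ is the first variable after the left parenthesis matched with the last right parenthesis of that block. $\widehat{\mathbb{N}}^n$ is the set of names of trees in $Y_n$. For $k\in\mathbb{N}$ and $\vec w\in\widehat{\mathbb{N}}^m$, $k\triangleright\vec w:=(k\tilde+w_1,\ldots,k\tilde+w_m)$ where $k\tilde+1:=1$ and $k\tilde+a:=k+a$ for $a\neq1$. For trees $\pi\in Y_n$, $\tau\in Y_m$: $\pi\nearrow\tau$ ("over") is $\tau$ with its leftmost leaf identified with the root of $\pi$, and $\pi\nwarrow\tau$ ("under") is $\pi$ with its rightmost leaf identified with the root of $\tau$. An associative $L$-monoid (resp. $L$-algebra) is a set (resp. $K$-vector space) with two associative binary (resp. bilinear) operations $\nearrow,\nwarrow$ satisfying $(x\nearrow y)\nwarrow z=x\nearrow(y\nwarrow z)$. $\widehat{\mathbb{N}}^n$ is ordered componentwise; its minimum is $(1,\ldots,1)$, and $M(\vec v):=\mu((1,\ldots,1),\vec v)$ with $\mu$ the Möbius function of $(\widehat{\mathbb{N}}^n,\le)$. -}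

module Defs where

open import Data.Nat as ℕ using (ℕ; zero; suc; _+_; _≤_)
open import Data.Integer as ℤ using (ℤ)
open import Data.List using (List; []; _∷_; _++_; [_]; map; concatMap; filter; deduplicate; replicate; length; tabulate; applyUpTo)
open import Data.List.Properties using (≡-dec)
open import Data.List.Relation.Binary.Pointwise using (Pointwise)
open import Data.List.Relation.Binary.Pointwise.Properties using (decidable)
open import Data.Maybe using (Maybe; just; nothing)
open import Data.Product using (_×_; _,_; ∃)
open import Data.Fin using (Fin; toℕ)
open import Relation.Nullary using (yes; no; ¬_; Dec)
open import Relation.Nullary.Decidable using (⌊_⌋; _×-dec_; ¬?)
open import Relation.Binary.PropositionalEquality using (_≡_; _≢_)
open import Data.Bool using (Bool; if_then_else_)

data Tree : Set where
  leaf : Tree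
  node : Tree → Tree → Tree

size : Tree → ℕ
size leaf = 0
size (node a b) = suc (size a + size b)

leaves : Tree → ℕ
leaves leaf = 1
leaves (node a b) = leaves a + leaves b

_↗ᵗ_ : Tree → Tree → Tree
π ↗ᵗ leaf = π
π ↗ᵗ node a b = node (π ↗ᵗ a) b

_↖ᵗ_ : Tree → Tree → Tree
leaf ↖ᵗ τ = τ
node a b ↖ᵗ τ = node a (b ↖ᵗ τ)

data Tok : Set where
  lp  : Tok
  rp  : Tok
  var : ℕ → Tok

-- leaves numbered from k on; product of A,B written (AB)
renderFrom : ℕ → Tree → List Tok
renderFrom k leaf = [ var k ]
renderFrom k (node a b) = lp ∷ renderFrom k a ++ renderFrom (k + leaves a) b ++ [ rp ]

parenthesization : Tree → List Tok
parenthesization = renderFrom 1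

-- locate x_i : returns (reversed prefix before x_i , suffix after x_i)
findVar : ℕ → List Tok → List Tok → Maybe (List Tok × List Tok)
findVar i pre [] = nothing
findVar i pre (var j ∷ r) with i ℕ.≟ j
... | yes _ = just (pre , r)
... | no  _ = findVar i (var j ∷ pre) r
findVar i pre (t ∷ r) = findVar i (t ∷ pre) r

rpBlock : List Tok → ℕ
rpBlock (rp ∷ r) = suc (rpBlock r)
rpBlock _ = 0

-- scanning backwards (list given in reverse order) from just before a right
-- parenthesis: find the matching left parenthesis and return the first
-- variable after it (= last variable seen while scanning backwards)
matchScan : ℕ → ℕ → List Tok → ℕ
matchScan d lv [] = 0
matchScan d lv (var j ∷ r) = matchScan d j r
matchScan d lv (rp ∷ r) = matchScan (suc d) lv r
matchScan zero lv (lp ∷ r) = lv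
matchScan (suc d) lv (lp ∷ r) = matchScan d lv r

nameEntry : List Tok → ℕ → ℕ
nameEntry w i with findVar i [] w
... | nothing = 0
... | just (lp ∷ pre , post) = i
... | just (pre , post) with rpBlock post
...   | zero = 0
...   | suc k = matchScan 0 0 (replicate k rp ++ var i ∷ pre)

name : Tree → List ℕ
name τ = tabulate {n = size τ} (λ (i : Fin (size τ)) → nameEntry (parenthesization τ) (suc (toℕ i)))

NHat : ℕ → List ℕ → Set
NHat n v = ∃ λ (τ : Tree) → size τ ≡ n × name τ ≡ v

_+̃_ : ℕ → ℕ → ℕ
k +̃ 1 = 1
k +̃ a = k + a

_▷_ : ℕ → List ℕ → List ℕ
k ▷ w = map (k +̃_) w

_↗_ : List ℕ → List ℕ → List ℕ
v ↗ w = v ++ (length v ▷ w)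

_↖_ : List ℕ → List ℕ → List ℕ
v ↖ w = v ++ map (λ a → a + length v) w

-- all trees of height ≤ h (every tree in Y_n has height ≤ n)
treesOfHeight≤ : ℕ → List Tree
treesOfHeight≤ zero = [ leaf ]
treesOfHeight≤ (suc h) = leaf ∷ concatMap (λ a → map (node a) (treesOfHeight≤ h)) (treesOfHeight≤ h)

elemsNHat : ℕ → List (List ℕ)
elemsNHat n = deduplicate (≡-dec ℕ._≟_)
  (map name (filter (λ τ → size τ ℕ.≟ n) (treesOfHeight≤ n)))

_≤ᶜ_ : List ℕ → List ℕ → Set
_≤ᶜ_ = Pointwise _≤_

_≤ᶜ?_ : (v w : List ℕ) → Dec (v ≤ᶜ w)
_≤ᶜ?_ = decidable ℕ._≤?_

sumℤ : List ℤ → ℤ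
sumℤ [] = ℤ.0ℤ
sumℤ (x ∷ xs) = x ℤ.+ sumℤ xs

-- The fuel argument bounds the length of strict chains.
mobiusFuel : ℕ → List (List ℕ) → List ℕ → List ℕ → ℤ
mobiusFuel zero els x y = ℤ.0ℤ
mobiusFuel (suc f) els x y with ≡-dec ℕ._≟_ x y
... | yes _ = ℤ.1ℤ
... | no _ with x ≤ᶜ? y
...   | no _ = ℤ.0ℤ
...   | yes _ = ℤ.- sumℤ (map (mobiusFuel f els x)
          (filter (λ z → (x ≤ᶜ? z) ×-dec ((z ≤ᶜ? y) ×-dec ¬? (≡-dec ℕ._≟_ z y))) els))

mobius : List (List ℕ) → List ℕ → List ℕ → ℤ
mobius els = mobiusFuel (suc (length els)) els

M : List ℕ → ℤ
M v = mobius (elemsNHat (length v)) (replicate (length v) 1) v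

idName : ℕ → List ℕ
idName m = applyUpTo suc m

{-# OPTIONS --safe #-}
-- The name of a tree is computed recursively: when the leaves of node a b are numbered
-- from k, the last leaf of a gets the entry k, and the other entries are those of a and
-- of b (numbered from k + leaves a). Grafting therefore acts on names by ↗ and ↖, which
-- gives the closure, the L-monoid axioms and the morphism property.
--
-- M is the product over the positions i of a sign: 1 if vᵢ = 1, -1 if vᵢ = i ≥ 2, and 0
-- otherwise. This product satisfies the recursion of the Möbius function: below a name
-- y ≠ (1,…,1) its nonzero terms are the names with entries in {1, i}, and y has an entry
-- yⱼ ≥ j with j ≥ 2, so toggling the j-th entry between 1 and j cancels them in pairs.
-- The rules for M (v ↗ w) and M (v ↖ w) follow, since ↗ fixes the entries 1 and shifts
-- the others together with their positions, while ↖ shifts every entry of w away from 1.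

module Submission where

open import Defs
open import Data.Nat using (ℕ; _+_; _≤_)
open import Data.Integer using (ℤ; -1ℤ; 0ℤ; _*_; _^_)
open import Data.List using (List)
open import Data.Product using (_×_)
open import Relation.Binary.PropositionalEquality using (_≡_; _≢_)

open import Data.Integer as ℤ using (1ℤ)
import Data.Integer.Properties as ℤ
open import Data.Nat as ℕ using (zero; suc; _<_; z≤n; s≤s; _≟_; _≤?_)
open import Data.Nat.Properties
open import Algebra.Properties.AbelianGroup ℤ.+-0-abelianGroup using (inverseˡ-unique)
open import Algebra.Properties.CommutativeSemigroup +-commutativeSemigroup using (xy∙z≈xz∙y)
open import Data.Bool using (if_then_else_)
open import Data.Empty using (⊥; ⊥-elim)
open import Data.Fin using (toℕ)
open import Data.List using ([]; _∷_; _++_; [_]; _ʳ++_; map; filter; foldr; length; replicate; tabulate; applyUpTo)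
open import Data.List.Properties
  using (++-assoc; ++-identityʳ; ++-ʳ++; tabulate-cong; map-++; map-∘; map-cong-local; length-++; length-map;
         length-replicate; length-filter; filter-++; filter-accept; filter-reject; ∷-injectiveʳ; ≡-dec)
open import Data.List.Membership.Propositional using (_∈_)
open import Data.List.Membership.Propositional.Properties
  using (∈-map⁺; ∈-map⁻; ∈-++⁺ˡ; ∈-++⁺ʳ; ∈-++⁻; ∈-filter⁺; ∈-filter⁻; ∈-concatMap⁺;
         ∈-deduplicate⁺; ∈-deduplicate⁻)
open import Data.List.Membership.Propositional.Properties.WithK using (unique∧set⇒bag)
import Data.List.Membership.DecPropositional as DecMembership
open import Data.List.Relation.Binary.BagAndSetEquality using (∼bag⇒↭)
open import Data.List.Relation.Binary.Permutation.Propositional using (_↭_; ↭⇒↭ₛ)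
import Data.List.Relation.Binary.Permutation.Propositional.Properties as ↭
import Data.List.Relation.Binary.Permutation.Setoid.Properties as ↭ₛ
open import Data.List.Relation.Binary.Pointwise as Pointwise using ([]; _∷_)
import Data.List.Relation.Binary.Pointwise.Properties as Pointwise
open import Data.List.Relation.Unary.All as All using (All; []; _∷_)
open import Data.List.Relation.Unary.All.Properties using (++⁺)
open import Data.List.Relation.Unary.AllPairs using ([]; _∷_)
open import Data.List.Relation.Unary.Any as Any using (here; there)
open import Data.List.Relation.Unary.Unique.Propositional using (Unique)
import Data.List.Relation.Unary.Unique.Propositional.Properties as Unique
open import Data.List.Relation.Unary.Unique.DecPropositional.Properties (≡-dec ℕ._≟_) using (deduplicate-!)
open import Data.Maybe using (just)
open import Data.Product using (_,_; ∃; proj₂)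
open import Data.Sum using (_⊎_; inj₁; inj₂)
open import Data.Unit using (⊤; tt)
open import Function using (_∘_)
open import Function.Bundles using (_⇔_; mk⇔)
open import Level using (0ℓ)
open import Relation.Binary.PropositionalEquality hiding ([_])
open import Relation.Nullary using (Dec; yes; no; ¬_; does)
open import Relation.Nullary.Decidable using (_×-dec_; ¬?; dec-true; dec-false)
open import Relation.Unary using (Pred; Decidable)
open ≡-Reasoning

-- Names read off the parenthesization

-- The last leaf of the left subtree either
-- directly follows the opening parenthesis of the root or closes the left subtree, whose
-- first leaf is k.
nameFrom : ℕ → Tree → List ℕ
nameFrom k leaf       = []
nameFrom k (node a b) = nameFrom k a ++ k ∷ nameFrom (k + leaves a) b

tabulateFrom : ℕ → ℕ → (ℕ → ℕ) → List ℕ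
tabulateFrom k zero    f = []
tabulateFrom k (suc n) f = f k ∷ tabulateFrom (suc k) n f

tabulateFrom-++ : ∀ k m n f → tabulateFrom k (m + n) f ≡ tabulateFrom k m f ++ tabulateFrom (k + m) n f
tabulateFrom-++ k zero    n f rewrite +-identityʳ k = refl
tabulateFrom-++ k (suc m) n f rewrite +-suc k m = cong (f k ∷_) (tabulateFrom-++ (suc k) m n f)

tabulate-tabulateFrom : ∀ n k f → tabulate {n = n} (λ i → f (k + toℕ i)) ≡ tabulateFrom k n f
tabulate-tabulateFrom zero    k f = refl
tabulate-tabulateFrom (suc n) k f = cong₂ _∷_ (cong f (+-identityʳ k))
  (trans (tabulate-cong (λ i → cong f (+-suc k (toℕ i)))) (tabulate-tabulateFrom n (suc k) f))

leaves≡1+size : ∀ t → leaves t ≡ suc (size t)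
leaves≡1+size leaf       = refl
leaves≡1+size (node a b) rewrite leaves≡1+size a | leaves≡1+size b = cong suc (+-suc (size a) (size b))

lastLeafIndex-node : ∀ k a b → k + leaves a + size b ≡ k + size (node a b)
lastLeafIndex-node k a b rewrite leaves≡1+size a = +-assoc k (suc (size a)) (size b)

rightDepth : Tree → ℕ
rightDepth leaf       = 0
rightDepth (node a b) = suc (rightDepth b)

beforeLastLeaf : ℕ → Tree → List Tok
beforeLastLeaf k leaf       = []
beforeLastLeaf k (node a b) = lp ∷ renderFrom k a ++ beforeLastLeaf (k + leaves a) b

replicate-∷ʳ : ∀ {A : Set} r (x : A) ys → replicate r x ++ x ∷ ys ≡ x ∷ replicate r x ++ ys
replicate-∷ʳ zero    x ys = refl
replicate-∷ʳ (suc r) x ys = cong (x ∷_) (replicate-∷ʳ r x ys)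

renderFrom-lastLeaf : ∀ k t →
  renderFrom k t ≡ beforeLastLeaf k t ++ var (k + size t) ∷ replicate (rightDepth t) rp
renderFrom-lastLeaf k leaf rewrite +-identityʳ k = refl
renderFrom-lastLeaf k (node a b) = begin
    lp ∷ Ra ++ renderFrom kb b ++ [ rp ]
  ≡⟨ cong (λ z → lp ∷ Ra ++ z ++ [ rp ]) (renderFrom-lastLeaf kb b) ⟩
    lp ∷ Ra ++ (beforeLastLeaf kb b ++ var (kb + size b) ∷ replicate (rightDepth b) rp) ++ [ rp ]
  ≡⟨ cong (λ z → lp ∷ Ra ++ z) (++-assoc (beforeLastLeaf kb b) _ [ rp ]) ⟩
    lp ∷ Ra ++ beforeLastLeaf kb b ++ var (kb + size b) ∷ (replicate (rightDepth b) rp ++ [ rp ])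
  ≡⟨ cong₂ (λ i z → lp ∷ Ra ++ beforeLastLeaf kb b ++ var i ∷ z)
       (lastLeafIndex-node k a b) (trans (replicate-∷ʳ (rightDepth b) rp []) (cong (rp ∷_) (++-identityʳ _))) ⟩
    lp ∷ Ra ++ beforeLastLeaf kb b ++ var (k + size (node a b)) ∷ replicate (rightDepth (node a b)) rp
  ≡⟨ cong (lp ∷_) (++-assoc Ra (beforeLastLeaf kb b) _) ⟨
    beforeLastLeaf k (node a b) ++ var (k + size (node a b)) ∷ replicate (rightDepth (node a b)) rp
  ∎
  where
  kb = k + leaves a
  Ra = renderFrom k a

replicate-ʳ++ : ∀ {A : Set} r (x : A) ys → replicate r x ʳ++ ys ≡ replicate r x ++ ys
replicate-ʳ++ zero    x ys = refl
replicate-ʳ++ (suc r) x ys = trans (replicate-ʳ++ r x (x ∷ ys)) (replicate-∷ʳ r x ys)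

renderFrom-ʳ++ : ∀ k t ys →
  renderFrom k t ʳ++ ys ≡ replicate (rightDepth t) rp ++ var (k + size t) ∷ beforeLastLeaf k t ʳ++ ys
renderFrom-ʳ++ k t ys = begin
    renderFrom k t ʳ++ ys
  ≡⟨ cong (_ʳ++ ys) (renderFrom-lastLeaf k t) ⟩
    (beforeLastLeaf k t ++ var (k + size t) ∷ replicate (rightDepth t) rp) ʳ++ ys
  ≡⟨ ++-ʳ++ (beforeLastLeaf k t) ⟩
    replicate (rightDepth t) rp ʳ++ var (k + size t) ∷ beforeLastLeaf k t ʳ++ ys
  ≡⟨ replicate-ʳ++ (rightDepth t) rp _ ⟩
    replicate (rightDepth t) rp ++ var (k + size t) ∷ beforeLastLeaf k t ʳ++ ys
  ∎

matchScan-renderFrom : ∀ t k d j ys → matchScan d j (renderFrom k t ʳ++ ys) ≡ matchScan d k ys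
matchScan-renderFrom leaf       k d j ys = refl
matchScan-renderFrom (node a b) k d j ys = begin
    matchScan d j ((lp ∷ Ra ++ Rb ++ [ rp ]) ʳ++ ys)
  ≡⟨ cong (matchScan d j) (trans (++-ʳ++ Ra) (++-ʳ++ Rb)) ⟩
    matchScan (suc d) j (Rb ʳ++ Ra ʳ++ lp ∷ ys)
  ≡⟨ matchScan-renderFrom b (k + leaves a) (suc d) j _ ⟩
    matchScan (suc d) (k + leaves a) (Ra ʳ++ lp ∷ ys)
  ≡⟨ matchScan-renderFrom a k (suc d) _ _ ⟩
    matchScan d k ys
  ∎
  where
  Ra = renderFrom k a
  Rb = renderFrom (k + leaves a) b

VarBelow : ℕ → Tok → Set
VarBelow i (var j) = j < i
VarBelow i _       = ⊤

VarBelow-mono : ∀ {i j} → i ≤ j → ∀ {xs} → All (VarBelow i) xs → All (VarBelow j) xs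
VarBelow-mono {i} {j} i≤j = All.map (λ {x} → mono x)
  where
  mono : ∀ x → VarBelow i x → VarBelow j x
  mono lp      _   = tt
  mono rp      _   = tt
  mono (var _) v<i = <-≤-trans v<i i≤j

findVar-++ : ∀ {i} acc xs ys → All (VarBelow i) xs → findVar i acc (xs ++ var i ∷ ys) ≡ just (xs ʳ++ acc , ys)
findVar-++ {i} acc [] ys [] rewrite ≟-diag {i} refl = refl
findVar-++ acc (lp ∷ xs) ys (_ ∷ xs<i) = findVar-++ (lp ∷ acc) xs ys xs<i
findVar-++ acc (rp ∷ xs) ys (_ ∷ xs<i) = findVar-++ (rp ∷ acc) xs ys xs<i
findVar-++ {i} acc (var j ∷ xs) ys (j<i ∷ xs<i) rewrite ≢-≟-identity _≟_ (>⇒≢ j<i) =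
  findVar-++ (var j ∷ acc) xs ys xs<i

renderFrom-vars : ∀ k t → All (VarBelow (suc (k + size t))) (renderFrom k t)
beforeLastLeaf-vars : ∀ k t → All (VarBelow (k + size t)) (beforeLastLeaf k t)

renderFrom-vars k t = subst (All (VarBelow (suc (k + size t)))) (sym (renderFrom-lastLeaf k t))
  (++⁺ (VarBelow-mono (n≤1+n _) (beforeLastLeaf-vars k t)) (≤-refl ∷ rps (rightDepth t)))
  where
  rps : ∀ r → All (VarBelow (suc (k + size t))) (replicate r rp)
  rps zero    = []
  rps (suc r) = tt ∷ rps r

beforeLastLeaf-vars k leaf       = []
beforeLastLeaf-vars k (node a b) =
  tt ∷ ++⁺ (VarBelow-mono (≤-trans (≤-reflexive (sym (+-suc k (size a))))
                                   (+-monoʳ-≤ k (s≤s (m≤m+n (size a) (size b)))))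
                          (renderFrom-vars k a))
           (subst (λ i → All (VarBelow i) (beforeLastLeaf (k + leaves a) b)) (lastLeafIndex-node k a b)
             (beforeLastLeaf-vars (k + leaves a) b))

findVar-lastLeaf : ∀ k t P X → All (VarBelow k) P →
  findVar (k + size t) [] (P ++ renderFrom k t ++ X)
    ≡ just (beforeLastLeaf k t ʳ++ P ʳ++ [] , replicate (rightDepth t) rp ++ X)
findVar-lastLeaf k t P X P<k = begin
    findVar i [] (P ++ renderFrom k t ++ X)
  ≡⟨ cong (λ z → findVar i [] (P ++ z ++ X)) (renderFrom-lastLeaf k t) ⟩
    findVar i [] (P ++ (B ++ var i ∷ replicate (rightDepth t) rp) ++ X)
  ≡⟨ cong (λ z → findVar i [] (P ++ z)) (++-assoc B _ X) ⟩
    findVar i [] (P ++ B ++ var i ∷ replicate (rightDepth t) rp ++ X)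
  ≡⟨ cong (findVar i []) (++-assoc P B _) ⟨
    findVar i [] ((P ++ B) ++ var i ∷ replicate (rightDepth t) rp ++ X)
  ≡⟨ findVar-++ [] (P ++ B) _ (++⁺ (VarBelow-mono (m≤m+n k (size t)) P<k) (beforeLastLeaf-vars k t)) ⟩
    just ((P ++ B) ʳ++ [] , replicate (rightDepth t) rp ++ X)
  ≡⟨ cong (λ pre → just (pre , _)) (++-ʳ++ P) ⟩
    just (B ʳ++ P ʳ++ [] , replicate (rightDepth t) rp ++ X)
  ∎
  where
  i = k + size t
  B = beforeLastLeaf k t

HeadNotLp : List Tok → Set
HeadNotLp (lp ∷ _) = ⊥
HeadNotLp _        = ⊤

renderFrom-ʳ++-headNotLp : ∀ k t ys → HeadNotLp (renderFrom k t ʳ++ ys)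
renderFrom-ʳ++-headNotLp k t ys rewrite renderFrom-ʳ++ k t ys with rightDepth t
... | zero  = tt
... | suc _ = tt

beforeLastLeaf-ʳ++-headNotLp : ∀ k t ys → HeadNotLp ys → HeadNotLp (beforeLastLeaf k t ʳ++ ys)
beforeLastLeaf-ʳ++-headNotLp k leaf       ys h = h
beforeLastLeaf-ʳ++-headNotLp k (node a b) ys h
  rewrite ++-ʳ++ (renderFrom k a) {beforeLastLeaf (k + leaves a) b} {lp ∷ ys} =
  beforeLastLeaf-ʳ++-headNotLp (k + leaves a) b _ (renderFrom-ʳ++-headNotLp k a (lp ∷ ys))

nameEntry-afterLp : ∀ w i pre post → findVar i [] w ≡ just (lp ∷ pre , post) → nameEntry w i ≡ i
nameEntry-afterLp w i pre post found rewrite found = refl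

nameEntry-beforeRp : ∀ w i pre post r → findVar i [] w ≡ just (pre , post) → HeadNotLp pre →
  rpBlock post ≡ suc r → nameEntry w i ≡ matchScan 0 0 (replicate r rp ++ var i ∷ pre)
nameEntry-beforeRp w i []            post r found _ block rewrite found | block = refl
nameEntry-beforeRp w i (rp ∷ pre)    post r found _ block rewrite found | block = refl
nameEntry-beforeRp w i (var _ ∷ pre) post r found _ block rewrite found | block = refl

rpBlock-replicate : ∀ r ys → rpBlock (replicate r rp ++ ys) ≡ r + rpBlock ys
rpBlock-replicate zero    ys = refl
rpBlock-replicate (suc r) ys = cong suc (rpBlock-replicate r ys)

rpBlock-renderFrom : ∀ k t ys → rpBlock (renderFrom k t ++ ys) ≡ 0
rpBlock-renderFrom k leaf       ys = refl
rpBlock-renderFrom k (node a b) ys = refl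

nameEntry-firstLeaf : ∀ k P X → All (VarBelow k) P → nameEntry (P ++ lp ∷ var k ∷ X) k ≡ k
nameEntry-firstLeaf k P X P<k = nameEntry-afterLp (P ++ lp ∷ var k ∷ X) k (P ʳ++ []) X (begin
    findVar k [] (P ++ lp ∷ var k ∷ X)
  ≡⟨ cong (findVar k []) (++-assoc P [ lp ] (var k ∷ X)) ⟨
    findVar k [] ((P ++ [ lp ]) ++ var k ∷ X)
  ≡⟨ findVar-++ [] (P ++ [ lp ]) X (++⁺ P<k (tt ∷ [])) ⟩
    just ((P ++ [ lp ]) ʳ++ [] , X)
  ≡⟨ cong (λ pre → just (pre , X)) (++-ʳ++ P) ⟩
    just (lp ∷ P ʳ++ [] , X)
  ∎)

-- The block of right parentheses after the last leaf of a node closes the node itself.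
nameEntry-lastLeaf : ∀ k a b P X → All (VarBelow k) P → rpBlock X ≡ 0 →
  nameEntry (P ++ renderFrom k (node a b) ++ X) (k + size (node a b)) ≡ k
nameEntry-lastLeaf k a b P X P<k X≢rp = begin
    nameEntry (P ++ renderFrom k t ++ X) i
  ≡⟨ nameEntry-beforeRp (P ++ renderFrom k t ++ X) i pre _ (rightDepth b) found headNotLp block ⟩
    matchScan 0 0 (replicate (rightDepth b) rp ++ var i ∷ pre)
  ≡⟨ cong (λ j → matchScan 0 0 (replicate (rightDepth b) rp ++ var j ∷ pre)) (lastLeafIndex-node k a b) ⟨
    matchScan 0 0 (replicate (rightDepth b) rp ++ var (kb + size b) ∷ beforeLastLeaf kb b ʳ++ Y)
  ≡⟨ cong (matchScan 0 0) (renderFrom-ʳ++ kb b Y) ⟨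
    matchScan 0 0 (renderFrom kb b ʳ++ Y)
  ≡⟨ matchScan-renderFrom b kb 0 0 Y ⟩
    matchScan 0 kb (renderFrom k a ʳ++ lp ∷ P ʳ++ [])
  ≡⟨ matchScan-renderFrom a k 0 kb _ ⟩
    k
  ∎
  where
  t = node a b
  i = k + size t
  kb = k + leaves a
  Y = renderFrom k a ʳ++ lp ∷ P ʳ++ []
  pre = beforeLastLeaf kb b ʳ++ Y
  found : findVar i [] (P ++ renderFrom k t ++ X) ≡ just (pre , replicate (rightDepth t) rp ++ X)
  found = trans (findVar-lastLeaf k t P X P<k) (cong (λ z → just (z , _)) (++-ʳ++ (renderFrom k a)))
  headNotLp : HeadNotLp pre
  headNotLp = beforeLastLeaf-ʳ++-headNotLp kb b Y (renderFrom-ʳ++-headNotLp k a _)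
  block : rpBlock (replicate (rightDepth t) rp ++ X) ≡ suc (rightDepth b)
  block = trans (rpBlock-replicate (rightDepth t) X) (trans (cong (rightDepth t +_) X≢rp) (+-identityʳ _))

nameEntry-leftSubtree : ∀ k a P X → All (VarBelow k) P → rpBlock X ≡ 0 →
  nameEntry (P ++ lp ∷ renderFrom k a ++ X) (k + size a) ≡ k
nameEntry-leftSubtree k leaf P X P<k _ rewrite +-identityʳ k = nameEntry-firstLeaf k P X P<k
nameEntry-leftSubtree k (node a b) P X P<k X≢rp =
  trans (cong (λ w → nameEntry w (k + size (node a b))) (sym (++-assoc P [ lp ] _)))
        (nameEntry-lastLeaf k a b (P ++ [ lp ]) X (++⁺ P<k (tt ∷ [])) X≢rp)

nameEntries-renderFrom : ∀ t k P S → All (VarBelow k) P →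
  tabulateFrom k (size t) (nameEntry (P ++ renderFrom k t ++ S)) ≡ nameFrom k t
nameEntries-renderFrom leaf       k P S P<k = refl
nameEntries-renderFrom (node a b) k P S P<k = begin
    tabulateFrom k (suc (size a + size b)) f
  ≡⟨ cong (λ n → tabulateFrom k n f) (+-suc (size a) (size b)) ⟨
    tabulateFrom k (size a + suc (size b)) f
  ≡⟨ tabulateFrom-++ k (size a) (suc (size b)) f ⟩
    tabulateFrom k (size a) f ++ f (k + size a) ∷ tabulateFrom (suc (k + size a)) (size b) f
  ≡⟨ cong₂ _++_ left (cong₂ _∷_ middle right) ⟩
    nameFrom k a ++ k ∷ nameFrom kb b
  ∎
  where
  kb = k + leaves a
  Ra = renderFrom k a
  Rb = renderFrom kb b
  f = nameEntry (P ++ (lp ∷ Ra ++ Rb ++ [ rp ]) ++ S)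
  1+k+size≡kb : suc (k + size a) ≡ kb
  1+k+size≡kb = trans (sym (+-suc k (size a))) (cong (k +_) (sym (leaves≡1+size a)))
  word-left : P ++ (lp ∷ Ra ++ Rb ++ [ rp ]) ++ S ≡ P ++ lp ∷ Ra ++ (Rb ++ rp ∷ S)
  word-left = cong (λ z → P ++ lp ∷ z) (trans (++-assoc Ra _ S) (cong (Ra ++_) (++-assoc Rb [ rp ] S)))
  left : tabulateFrom k (size a) f ≡ nameFrom k a
  left = begin
      tabulateFrom k (size a) f
    ≡⟨ cong (λ w → tabulateFrom k (size a) (nameEntry w)) (trans word-left (sym (++-assoc P [ lp ] _))) ⟩
      tabulateFrom k (size a) (nameEntry ((P ++ [ lp ]) ++ Ra ++ (Rb ++ rp ∷ S)))
    ≡⟨ nameEntries-renderFrom a k (P ++ [ lp ]) (Rb ++ rp ∷ S) (++⁺ P<k (tt ∷ [])) ⟩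
      nameFrom k a
    ∎
  middle : f (k + size a) ≡ k
  middle = trans (cong (λ w → nameEntry w (k + size a)) word-left)
                 (nameEntry-leftSubtree k a P (Rb ++ rp ∷ S) P<k (rpBlock-renderFrom kb b (rp ∷ S)))
  prefix<kb : All (VarBelow kb) (P ++ lp ∷ Ra)
  prefix<kb = ++⁺ (VarBelow-mono (m≤m+n k (leaves a)) P<k)
                  (tt ∷ VarBelow-mono (≤-reflexive 1+k+size≡kb) (renderFrom-vars k a))
  right : tabulateFrom (suc (k + size a)) (size b) f ≡ nameFrom kb b
  right = begin
      tabulateFrom (suc (k + size a)) (size b) f
    ≡⟨ cong (λ j → tabulateFrom j (size b) f) 1+k+size≡kb ⟩
      tabulateFrom kb (size b) f
    ≡⟨ cong (λ w → tabulateFrom kb (size b) (nameEntry w)) (trans word-left (sym (++-assoc P (lp ∷ Ra) _))) ⟩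
      tabulateFrom kb (size b) (nameEntry ((P ++ lp ∷ Ra) ++ Rb ++ rp ∷ S))
    ≡⟨ nameEntries-renderFrom b kb (P ++ lp ∷ Ra) (rp ∷ S) prefix<kb ⟩
      nameFrom kb b
    ∎

name≡nameFrom : ∀ τ → name τ ≡ nameFrom 1 τ
name≡nameFrom τ = begin
    name τ
  ≡⟨ tabulate-tabulateFrom (size τ) 1 (nameEntry (renderFrom 1 τ)) ⟩
    tabulateFrom 1 (size τ) (nameEntry (renderFrom 1 τ))
  ≡⟨ cong (λ w → tabulateFrom 1 (size τ) (nameEntry w)) (++-identityʳ (renderFrom 1 τ)) ⟨
    tabulateFrom 1 (size τ) (nameEntry ([] ++ renderFrom 1 τ ++ []))
  ≡⟨ nameEntries-renderFrom τ 1 [] [] [] ⟩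
    nameFrom 1 τ
  ∎

+̃-≥2 : ∀ k {a} → 2 ≤ a → k +̃ a ≡ k + a
+̃-≥2 k {suc (suc a)} _ = refl
+̃-≥2 k {suc zero} (s≤s ())

▷-≥2 : ∀ k {w} → All (2 ≤_) w → k ▷ w ≡ map (_+ k) w
▷-≥2 k w≥2 = map-cong-local (All.map (λ {a} a≥2 → trans (+̃-≥2 k a≥2) (+-comm k a)) w≥2)

▷-▷ : ∀ k j {w} → All (1 ≤_) w → k ▷ (j ▷ w) ≡ (k + j) ▷ w
▷-▷ k j {w} w≥1 = trans (sym (map-∘ w)) (map-cong-local (All.map (λ {a} → shift a) w≥1))
  where
  shift : ∀ a → 1 ≤ a → k +̃ (j +̃ a) ≡ (k + j) +̃ a
  shift (suc zero)    _ = refl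
  shift (suc (suc a)) _ =
    trans (+̃-≥2 k (≤-trans (s≤s (s≤s z≤n)) (m≤n+m (suc (suc a)) j))) (sym (+-assoc k j (suc (suc a))))

-- Grafting and the operations on names

size-↗ᵗ : ∀ π τ → size (π ↗ᵗ τ) ≡ size π + size τ
size-↗ᵗ π leaf       = sym (+-identityʳ (size π))
size-↗ᵗ π (node a b) rewrite size-↗ᵗ π a =
  trans (cong suc (+-assoc (size π) (size a) (size b))) (sym (+-suc (size π) (size a + size b)))

size-↖ᵗ : ∀ π τ → size (π ↖ᵗ τ) ≡ size π + size τ
size-↖ᵗ leaf       τ = refl
size-↖ᵗ (node a b) τ rewrite size-↖ᵗ b τ = cong suc (sym (+-assoc (size a) (size b) (size τ)))

leaves-↗ᵗ : ∀ π τ → leaves (π ↗ᵗ τ) ≡ size π + leaves τ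
leaves-↗ᵗ π leaf       = trans (leaves≡1+size π) (+-comm 1 (size π))
leaves-↗ᵗ π (node a b) rewrite leaves-↗ᵗ π a = +-assoc (size π) (leaves a) (leaves b)

length-nameFrom : ∀ k t → length (nameFrom k t) ≡ size t
length-nameFrom k leaf       = refl
length-nameFrom k (node a b)
  rewrite length-++ (nameFrom k a) {k ∷ nameFrom (k + leaves a) b}
        | length-nameFrom k a | length-nameFrom (k + leaves a) b = +-suc (size a) (size b)

nameFrom-≥ : ∀ k t → All (k ≤_) (nameFrom k t)
nameFrom-≥ k leaf       = []
nameFrom-≥ k (node a b) =
  ++⁺ (nameFrom-≥ k a) (≤-refl ∷ All.map (≤-trans (m≤m+n k (leaves a))) (nameFrom-≥ (k + leaves a) b))

nameFrom-+ : ∀ k n t → nameFrom (k + n) t ≡ map (_+ n) (nameFrom k t)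
nameFrom-+ k n leaf       = refl
nameFrom-+ k n (node a b) = begin
    nameFrom (k + n) a ++ k + n ∷ nameFrom (k + n + leaves a) b
  ≡⟨ cong₂ (λ u v → u ++ k + n ∷ v) (nameFrom-+ k n a)
       (trans (cong (λ j → nameFrom j b) (xy∙z≈xz∙y k n (leaves a))) (nameFrom-+ (k + leaves a) n b)) ⟩
    map (_+ n) (nameFrom k a) ++ k + n ∷ map (_+ n) (nameFrom (k + leaves a) b)
  ≡⟨ map-++ (_+ n) (nameFrom k a) (k ∷ nameFrom (k + leaves a) b) ⟨
    map (_+ n) (nameFrom k (node a b))
  ∎

nameFrom-↖ᵗ : ∀ k π τ → nameFrom k (π ↖ᵗ τ) ≡ nameFrom k π ++ nameFrom (k + size π) τ
nameFrom-↖ᵗ k leaf       τ rewrite +-identityʳ k = refl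
nameFrom-↖ᵗ k (node a b) τ = begin
    nameFrom k a ++ k ∷ nameFrom (k + leaves a) (b ↖ᵗ τ)
  ≡⟨ cong (λ z → nameFrom k a ++ k ∷ z) (nameFrom-↖ᵗ (k + leaves a) b τ) ⟩
    nameFrom k a ++ k ∷ nameFrom (k + leaves a) b ++ nameFrom (k + leaves a + size b) τ
  ≡⟨ cong (λ j → nameFrom k a ++ k ∷ nameFrom (k + leaves a) b ++ nameFrom j τ) (lastLeafIndex-node k a b) ⟩
    nameFrom k a ++ (k ∷ nameFrom (k + leaves a) b) ++ nameFrom (k + size (node a b)) τ
  ≡⟨ ++-assoc (nameFrom k a) _ _ ⟨
    nameFrom k (node a b) ++ nameFrom (k + size (node a b)) τ
  ∎

-- The entries of τ move up by size π, except the entries 1: they point to the leftmost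
-- leaf of τ, which is replaced by π, whose first leaf is still x₁.
nameFrom-↗ᵗ : ∀ π τ → nameFrom 1 (π ↗ᵗ τ) ≡ nameFrom 1 π ++ (size π ▷ nameFrom 1 τ)
nameFrom-↗ᵗ π leaf       = sym (++-identityʳ (nameFrom 1 π))
nameFrom-↗ᵗ π (node a b) = begin
    nameFrom 1 (π ↗ᵗ a) ++ 1 ∷ nameFrom (1 + leaves (π ↗ᵗ a)) b
  ≡⟨ cong₂ (λ u v → u ++ 1 ∷ v) (nameFrom-↗ᵗ π a) right ⟩
    (nameFrom 1 π ++ (n ▷ nameFrom 1 a)) ++ 1 ∷ (n ▷ nameFrom (1 + leaves a) b)
  ≡⟨ ++-assoc (nameFrom 1 π) _ _ ⟩
    nameFrom 1 π ++ (n ▷ nameFrom 1 a) ++ 1 ∷ (n ▷ nameFrom (1 + leaves a) b)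
  ≡⟨ cong (nameFrom 1 π ++_) (map-++ (n +̃_) (nameFrom 1 a) (1 ∷ nameFrom (1 + leaves a) b)) ⟨
    nameFrom 1 π ++ (n ▷ nameFrom 1 (node a b))
  ∎
  where
  n = size π
  2≤1+leaves : 2 ≤ 1 + leaves a
  2≤1+leaves rewrite leaves≡1+size a = s≤s (s≤s z≤n)
  right : nameFrom (1 + leaves (π ↗ᵗ a)) b ≡ n ▷ nameFrom (1 + leaves a) b
  right = begin
      nameFrom (1 + leaves (π ↗ᵗ a)) b
    ≡⟨ cong (λ l → nameFrom (1 + l) b) (trans (leaves-↗ᵗ π a) (+-comm n (leaves a))) ⟩
      nameFrom (1 + leaves a + n) b
    ≡⟨ nameFrom-+ (1 + leaves a) n b ⟩
      map (_+ n) (nameFrom (1 + leaves a) b)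
    ≡⟨ ▷-≥2 n (All.map (≤-trans 2≤1+leaves) (nameFrom-≥ (1 + leaves a) b)) ⟨
      n ▷ nameFrom (1 + leaves a) b
    ∎

length-name : ∀ τ → length (name τ) ≡ size τ
length-name τ rewrite name≡nameFrom τ = length-nameFrom 1 τ

name-≥1 : ∀ τ → All (1 ≤_) (name τ)
name-≥1 τ rewrite name≡nameFrom τ = nameFrom-≥ 1 τ

name-↗ᵗ : ∀ π τ → name (π ↗ᵗ τ) ≡ name π ↗ name τ
name-↗ᵗ π τ rewrite name≡nameFrom (π ↗ᵗ τ) | name≡nameFrom π | name≡nameFrom τ | length-nameFrom 1 π =
  nameFrom-↗ᵗ π τ

name-↖ᵗ : ∀ π τ → name (π ↖ᵗ τ) ≡ name π ↖ name τ
name-↖ᵗ π τ rewrite name≡nameFrom (π ↖ᵗ τ) | name≡nameFrom π | name≡nameFrom τ | length-nameFrom 1 π =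
  trans (nameFrom-↖ᵗ 1 π τ) (cong (nameFrom 1 π ++_) (nameFrom-+ 1 (size π) τ))

↗-NHat : ∀ {n m v w} → NHat n v → NHat m w → NHat (n + m) (v ↗ w)
↗-NHat (π , refl , refl) (τ , refl , refl) = π ↗ᵗ τ , size-↗ᵗ π τ , name-↗ᵗ π τ

↖-NHat : ∀ {n m v w} → NHat n v → NHat m w → NHat (n + m) (v ↖ w)
↖-NHat (π , refl , refl) (τ , refl , refl) = π ↖ᵗ τ , size-↖ᵗ π τ , name-↖ᵗ π τ

length-↗ : ∀ u v → length (u ↗ v) ≡ length u + length v
length-↗ u v rewrite length-++ u {length u ▷ v} | length-map (length u +̃_) v = refl

length-↖ : ∀ u v → length (u ↖ v) ≡ length u + length v
length-↖ u v rewrite length-++ u {map (_+ length u) v} | length-map (_+ length u) v = refl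

↗-assoc : ∀ u v {w} → All (1 ≤_) w → (u ↗ v) ↗ w ≡ u ↗ (v ↗ w)
↗-assoc u v {w} w≥1 = begin
    (u ++ (length u ▷ v)) ++ (length (u ↗ v) ▷ w)
  ≡⟨ ++-assoc u _ _ ⟩
    u ++ (length u ▷ v) ++ (length (u ↗ v) ▷ w)
  ≡⟨ cong (λ z → u ++ (length u ▷ v) ++ z)
       (trans (cong (_▷ w) (length-↗ u v)) (sym (▷-▷ (length u) (length v) w≥1))) ⟩
    u ++ (length u ▷ v) ++ (length u ▷ (length v ▷ w))
  ≡⟨ cong (u ++_) (map-++ (length u +̃_) v _) ⟨
    u ++ (length u ▷ (v ++ (length v ▷ w)))
  ∎

↖-assoc : ∀ u v w → (u ↖ v) ↖ w ≡ u ↖ (v ↖ w)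
↖-assoc u v w = begin
    (u ++ map (_+ length u) v) ++ map (_+ length (u ↖ v)) w
  ≡⟨ ++-assoc u _ _ ⟩
    u ++ map (_+ length u) v ++ map (_+ length (u ↖ v)) w
  ≡⟨ cong (λ z → u ++ map (_+ length u) v ++ z)
          (trans (map-cong-local (All.tabulate (λ {a} _ → shift a))) (map-∘ w)) ⟩
    u ++ map (_+ length u) v ++ map (_+ length u) (map (_+ length v) w)
  ≡⟨ cong (u ++_) (map-++ (_+ length u) v _) ⟨
    u ++ map (_+ length u) (v ++ map (_+ length v) w)
  ∎
  where
  shift : ∀ a → a + length (u ↖ v) ≡ a + length v + length u
  shift a = trans (cong (a +_) (trans (length-↖ u v) (+-comm (length u) (length v)))) (sym (+-assoc a _ _))

↗-↖-assoc : ∀ u v {w} → 1 ≤ length v → All (1 ≤_) w → (u ↗ v) ↖ w ≡ u ↗ (v ↖ w)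
↗-↖-assoc u v {w} v≢[] w≥1 = begin
    (u ++ (length u ▷ v)) ++ map (_+ length (u ↗ v)) w
  ≡⟨ ++-assoc u _ _ ⟩
    u ++ (length u ▷ v) ++ map (_+ length (u ↗ v)) w
  ≡⟨ cong (λ z → u ++ (length u ▷ v) ++ z)
          (trans (map-cong-local (All.map (λ {a} → shift a) w≥1)) (map-∘ w)) ⟩
    u ++ (length u ▷ v) ++ (length u ▷ map (_+ length v) w)
  ≡⟨ cong (u ++_) (map-++ (length u +̃_) v _) ⟨
    u ++ (length u ▷ (v ++ map (_+ length v) w))
  ∎
  where
  shift : ∀ a → 1 ≤ a → a + length (u ↗ v) ≡ length u +̃ (a + length v)
  shift a a≥1 = begin
      a + length (u ↗ v)
    ≡⟨ cong (a +_) (trans (length-↗ u v) (+-comm (length u) (length v))) ⟩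
      a + (length v + length u)
    ≡⟨ +-assoc a (length v) (length u) ⟨
      a + length v + length u
    ≡⟨ +-comm (a + length v) (length u) ⟩
      length u + (a + length v)
    ≡⟨ +̃-≥2 (length u) (+-mono-≤ a≥1 v≢[]) ⟨
      length u +̃ (a + length v)
    ∎

-- Sums and Möbius functions over lists

sumℤ≡foldr : ∀ xs → sumℤ xs ≡ foldr ℤ._+_ 0ℤ xs
sumℤ≡foldr []       = refl
sumℤ≡foldr (x ∷ xs) = cong (ℤ._+_ x) (sumℤ≡foldr xs)

sumℤ-↭ : ∀ {xs ys} → xs ↭ ys → sumℤ xs ≡ sumℤ ys
sumℤ-↭ {xs} {ys} p = begin
  sumℤ xs                ≡⟨ sumℤ≡foldr xs ⟩
  foldr ℤ._+_ 0ℤ xs      ≡⟨ ↭ₛ.foldr-commMonoid (setoid ℤ) ℤ.+-0-isCommutativeMonoid (↭⇒↭ₛ p) ⟩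
  foldr ℤ._+_ 0ℤ ys      ≡⟨ sumℤ≡foldr ys ⟨
  sumℤ ys                ∎

sumℤ-++ : ∀ xs ys → sumℤ (xs ++ ys) ≡ sumℤ xs ℤ.+ sumℤ ys
sumℤ-++ []       ys = sym (ℤ.+-identityˡ (sumℤ ys))
sumℤ-++ (x ∷ xs) ys = trans (cong (ℤ._+_ x) (sumℤ-++ xs ys)) (sym (ℤ.+-assoc x (sumℤ xs) (sumℤ ys)))

sumℤ-*ˡ : ∀ {A : Set} c (f : A → ℤ) L → sumℤ (map (λ z → c * f z) L) ≡ c * sumℤ (map f L)
sumℤ-*ˡ c f []      = sym (ℤ.*-zeroʳ c)
sumℤ-*ˡ c f (x ∷ L) = trans (cong (ℤ._+_ (c * f x)) (sumℤ-*ˡ c f L)) (sym (ℤ.*-distribˡ-+ c (f x) _))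

unique-↭ : ∀ {A : Set} {xs ys : List A} → Unique xs → Unique ys → (∀ {z} → z ∈ xs ⇔ z ∈ ys) → xs ↭ ys
unique-↭ xs! ys! same = ∼bag⇒↭ (unique∧set⇒bag xs! ys! same)

sumℤ-filter-support : ∀ {A : Set} {P : Pred A 0ℓ} (P? : Decidable P) (f : A → ℤ) L →
  (∀ {z} → z ∈ L → ¬ P z → f z ≡ 0ℤ) → sumℤ (map f (filter P? L)) ≡ sumℤ (map f L)
sumℤ-filter-support P? f []      _ = refl
sumℤ-filter-support P? f (x ∷ L) f≡0 with P? x
... | yes _  = cong (ℤ._+_ (f x)) (sumℤ-filter-support P? f L (λ z∈ → f≡0 (there z∈)))
... | no ¬px = begin
    sumℤ (map f (filter P? L))   ≡⟨ sumℤ-filter-support P? f L (λ z∈ → f≡0 (there z∈)) ⟩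
    sumℤ (map f L)               ≡⟨ ℤ.+-identityˡ _ ⟨
    0ℤ ℤ.+ sumℤ (map f L)        ≡⟨ cong (ℤ._+ sumℤ (map f L)) (f≡0 (here refl) ¬px) ⟨
    f x ℤ.+ sumℤ (map f L)       ∎

sumℤ-support : ∀ (f : List ℕ → ℤ) {L K} → Unique L → Unique K → (∀ {z} → z ∈ K → z ∈ L) →
  (∀ {z} → z ∈ L → f z ≢ 0ℤ → z ∈ K) → sumℤ (map f L) ≡ sumℤ (map f K)
sumℤ-support f {L} {K} L! K! K⊆L support = begin
    sumℤ (map f L)                   ≡⟨ sumℤ-filter-support (_∈? K) f L outside≡0 ⟨
    sumℤ (map f (filter (_∈? K) L))  ≡⟨ sumℤ-↭ (↭.map⁺ f (unique-↭ filtered! K! same)) ⟩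
    sumℤ (map f K)                   ∎
  where
  open DecMembership (≡-dec ℕ._≟_) using (_∈?_)
  outside≡0 : ∀ {z} → z ∈ L → ¬ z ∈ K → f z ≡ 0ℤ
  outside≡0 {z} z∈L z∉K with f z ℤ.≟ 0ℤ
  ... | yes fz≡0 = fz≡0
  ... | no  fz≢0 = ⊥-elim (z∉K (support z∈L fz≢0))
  same : ∀ {z} → z ∈ filter (_∈? K) L ⇔ z ∈ K
  same = mk⇔ (λ z∈ → proj₂ (∈-filter⁻ (_∈? K) {xs = L} z∈))
             (λ z∈K → ∈-filter⁺ (_∈? K) (K⊆L z∈K) z∈K)
  filtered! = Unique.filter⁺ (_∈? K) L!

≤ᶜ-refl : ∀ {y} → y ≤ᶜ y
≤ᶜ-refl = Pointwise.refl ≤-refl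

≤ᶜ-trans : ∀ {x y z} → x ≤ᶜ y → y ≤ᶜ z → x ≤ᶜ z
≤ᶜ-trans = Pointwise.transitive ≤-trans

≤ᶜ-antisym : ∀ {x y} → x ≤ᶜ y → y ≤ᶜ x → x ≡ y
≤ᶜ-antisym x≤y y≤x = Pointwise.Pointwise-≡⇒≡ (Pointwise.antisymmetric ≤-antisym x≤y y≤x)

filter-≤ᶜ-∷-accept : ∀ {c b y} → c ≤ b → ∀ A →
  filter (_≤ᶜ? (b ∷ y)) (map (c ∷_) A) ≡ map (c ∷_) (filter (_≤ᶜ? y) A)
filter-≤ᶜ-∷-accept c≤b []      = refl
filter-≤ᶜ-∷-accept {c} {b} {y} c≤b (z ∷ A) = by-cases (z ≤ᶜ? y)
  where
  by-cases : Dec (z ≤ᶜ y) →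
    filter (_≤ᶜ? (b ∷ y)) (map (c ∷_) (z ∷ A)) ≡ map (c ∷_) (filter (_≤ᶜ? y) (z ∷ A))
  by-cases (yes z≤y) rewrite filter-accept (_≤ᶜ? y) {xs = A} z≤y =
    trans (filter-accept (_≤ᶜ? (b ∷ y)) {x = c ∷ z} {xs = map (c ∷_) A} (c≤b ∷ z≤y))
          (cong ((c ∷ z) ∷_) (filter-≤ᶜ-∷-accept c≤b A))
  by-cases (no z≰y) rewrite filter-reject (_≤ᶜ? y) {xs = A} z≰y =
    trans (filter-reject (_≤ᶜ? (b ∷ y)) {x = c ∷ z} {xs = map (c ∷_) A} λ { (_ ∷ z≤y) → z≰y z≤y })
          (filter-≤ᶜ-∷-accept c≤b A)

filter-≤ᶜ-∷-reject : ∀ {c b y} → ¬ c ≤ b → ∀ A → filter (_≤ᶜ? (b ∷ y)) (map (c ∷_) A) ≡ []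
filter-≤ᶜ-∷-reject c≰b []      = refl
filter-≤ᶜ-∷-reject {c} {b} {y} c≰b (z ∷ A) =
  trans (filter-reject (_≤ᶜ? (b ∷ y)) {x = c ∷ z} {xs = map (c ∷_) A} λ { (c≤b ∷ _) → c≰b c≤b })
        (filter-≤ᶜ-∷-reject c≰b A)

length-filter-mono : ∀ {A : Set} {P Q : Pred A 0ℓ} (P? : Decidable P) (Q? : Decidable Q) L →
  (∀ {z} → z ∈ L → P z → Q z) → length (filter P? L) ≤ length (filter Q? L)
length-filter-mono P? Q? []      P⇒Q = z≤n
length-filter-mono P? Q? (x ∷ L) P⇒Q with P? x | Q? x | length-filter-mono P? Q? L (λ z∈ → P⇒Q (there z∈))
... | yes px | no ¬qx | _  = ⊥-elim (¬qx (P⇒Q (here refl) px))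
... | yes _  | yes _  | ih = s≤s ih
... | no _   | yes _  | ih = m≤n⇒m≤1+n ih
... | no _   | no _   | ih = ih

length-filter-< : ∀ {A : Set} {P Q : Pred A 0ℓ} (P? : Decidable P) (Q? : Decidable Q) L →
  (∀ {z} → z ∈ L → P z → Q z) → ∀ {y} → y ∈ L → Q y → ¬ P y →
  length (filter P? L) < length (filter Q? L)
length-filter-< P? Q? (x ∷ L) P⇒Q (here refl) qx ¬px with P? x | Q? x
... | yes px | _      = ⊥-elim (¬px px)
... | no _   | no ¬qx = ⊥-elim (¬qx qx)
... | no _   | yes _  = s≤s (length-filter-mono P? Q? L (λ z∈ → P⇒Q (there z∈)))
length-filter-< P? Q? (x ∷ L) P⇒Q (there y∈) qy ¬py
  with P? x | Q? x | length-filter-< P? Q? L (λ z∈ → P⇒Q (there z∈)) y∈ qy ¬py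
... | yes px | no ¬qx | _  = ⊥-elim (¬qx (P⇒Q (here refl) px))
... | yes _  | yes _  | ih = s≤s ih
... | no _   | yes _  | ih = m≤n⇒m≤1+n ih
... | no _   | no _   | ih = ih

Interval? : (x y : List ℕ) → Decidable (λ z → x ≤ᶜ z × z ≤ᶜ y)
Interval? x y z = (x ≤ᶜ? z) ×-dec (z ≤ᶜ? y)

module _ (els : List (List ℕ)) (els! : Unique els) (x : List ℕ) where

  private
    -- The predicate filtered by mobiusFuel, so that its recursive sum matches definitionally.
    HalfOpen? : (y : List ℕ) → Decidable (λ z → x ≤ᶜ z × z ≤ᶜ y × z ≢ y)
    HalfOpen? y z = (x ≤ᶜ? z) ×-dec ((z ≤ᶜ? y) ×-dec ¬? (≡-dec ℕ._≟_ z y))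

  sumℤ-interval : ∀ (f : List ℕ → ℤ) {y} → y ∈ els → x ≤ᶜ y →
    sumℤ (map f (filter (Interval? x y) els)) ≡ f y ℤ.+ sumℤ (map f (filter (HalfOpen? y) els))
  sumℤ-interval f {y} y∈ x≤y =
    sumℤ-↭ (↭.map⁺ f (unique-↭ (Unique.filter⁺ (Interval? x y) els!) y∷halfOpen! same))
    where
    halfOpen! = Unique.filter⁺ (HalfOpen? y) els!
    y∷halfOpen! : Unique (y ∷ filter (HalfOpen? y) els)
    y∷halfOpen! = All.tabulate (λ z∈ y≡z → proj₂ (proj₂ (proj₂ (∈-filter⁻ (HalfOpen? y) {xs = els} z∈)))
                                                  (sym y≡z))
                ∷ halfOpen!
    same : ∀ {z} → z ∈ filter (Interval? x y) els ⇔ z ∈ y ∷ filter (HalfOpen? y) els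
    same {z} = mk⇔ to from
      where
      to : z ∈ filter (Interval? x y) els → z ∈ y ∷ filter (HalfOpen? y) els
      to z∈ with ∈-filter⁻ (Interval? x y) {xs = els} z∈ | ≡-dec ℕ._≟_ z y
      ... | _           , _   , _   | yes refl = here refl
      ... | z∈els , x≤z , z≤y | no z≢y   = there (∈-filter⁺ (HalfOpen? y) z∈els (x≤z , z≤y , z≢y))
      from : z ∈ y ∷ filter (HalfOpen? y) els → z ∈ filter (Interval? x y) els
      from (here refl) = ∈-filter⁺ (Interval? x y) y∈ (x≤y , ≤ᶜ-refl)
      from (there z∈) with ∈-filter⁻ (HalfOpen? y) {xs = els} z∈
      ... | z∈els , x≤z , z≤y , _ = ∈-filter⁺ (Interval? x y) z∈els (x≤z , z≤y)

  mobius-unique : ∀ (f : List ℕ → ℤ) → f x ≡ 1ℤ →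
    (∀ {y} → y ∈ els → x ≤ᶜ y → x ≢ y → sumℤ (map f (filter (Interval? x y) els)) ≡ 0ℤ) →
    ∀ {y} → y ∈ els → x ≤ᶜ y → mobius els x y ≡ f y
  mobius-unique f fx≡1 interval≡0 y∈ x≤y =
    fuel-≡ (suc (length els)) y∈ x≤y (s≤s (length-filter (_≤ᶜ? _) els))
    where
    -- The fuel suffices: the number of elements below y drops along the recursion.
    below : List ℕ → ℕ
    below y = length (filter (_≤ᶜ? y) els)
    fuel-≡ : ∀ fuel {y} → y ∈ els → x ≤ᶜ y → below y < fuel → mobiusFuel fuel els x y ≡ f y
    fuel-≡ zero       _  _   ()
    fuel-≡ (suc fuel) {y} y∈ x≤y below<fuel with ≡-dec ℕ._≟_ x y
    ... | yes refl = sym fx≡1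
    ... | no x≢y with x ≤ᶜ? y
    ...   | no x≰y = ⊥-elim (x≰y x≤y)
    ...   | yes _  = begin
        ℤ.- sumℤ (map (mobiusFuel fuel els x) (filter (HalfOpen? y) els))
      ≡⟨ cong (λ s → ℤ.- sumℤ s) (map-cong-local (All.tabulate (λ {z} z∈ → ih z∈))) ⟩
        ℤ.- sumℤ (map f (filter (HalfOpen? y) els))
      ≡⟨ inverseˡ-unique (f y) _ (trans (sym (sumℤ-interval f y∈ x≤y)) (interval≡0 y∈ x≤y x≢y)) ⟨
        f y
      ∎
      where
      ih : ∀ {z} → z ∈ filter (HalfOpen? y) els → mobiusFuel fuel els x z ≡ f z
      ih z∈ with ∈-filter⁻ (HalfOpen? y) {xs = els} z∈
      ... | z∈els , x≤z , z≤y , z≢y = fuel-≡ fuel z∈els x≤z (≤-trans below-z<y (≤-pred below<fuel))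
        where
        below-z<y = length-filter-< (_≤ᶜ? _) (_≤ᶜ? y) els (λ _ w≤z → ≤ᶜ-trans w≤z z≤y) y∈ ≤ᶜ-refl
                      (λ y≤z → z≢y (≤ᶜ-antisym z≤y y≤z))

-- The product formula for M

atomSign : ℕ → ℕ → ℤ
atomSign i a = if does (a ≟ 1) then 1ℤ else if does (a ≟ i) then -1ℤ else 0ℤ

mobiusFormula : ℕ → List ℕ → ℤ
mobiusFormula i []      = 1ℤ
mobiusFormula i (a ∷ v) = atomSign i a * mobiusFormula (suc i) v

atomSign-index : ∀ {i} → 2 ≤ i → atomSign i i ≡ -1ℤ
atomSign-index {i} i≥2 rewrite dec-false (i ≟ 1) (>⇒≢ i≥2) | dec-true (i ≟ i) refl = refl

atomSign-other : ∀ {i a} → a ≢ 1 → a ≢ i → atomSign i a ≡ 0ℤ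
atomSign-other {i} {a} a≢1 a≢i rewrite dec-false (a ≟ 1) a≢1 | dec-false (a ≟ i) a≢i = refl

atomSign≢0 : ∀ i a → atomSign i a ≢ 0ℤ → a ≡ 1 ⊎ a ≡ i
atomSign≢0 i a sign≢0 with a ≟ 1 | a ≟ i
... | yes a≡1 | _       = inj₁ a≡1
... | no _    | yes a≡i = inj₂ a≡i
... | no a≢1  | no a≢i  = ⊥-elim (sign≢0 (atomSign-other a≢1 a≢i))

atomSign-+ : ∀ n {i a} → 2 ≤ a → atomSign (i + n) (a + n) ≡ atomSign i a
atomSign-+ n {i} {a} a≥2 with a ≟ i
... | yes refl = trans (atomSign-index (≤-trans a≥2 (m≤m+n a n))) (sym (atomSign-index a≥2))
... | no a≢i   = trans (atomSign-other (>⇒≢ (≤-trans a≥2 (m≤m+n a n))) (a≢i ∘ +-cancelʳ-≡ n a i))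
                       (sym (atomSign-other (>⇒≢ a≥2) a≢i))

mobiusFormula-++ : ∀ i u v → mobiusFormula i (u ++ v) ≡ mobiusFormula i u * mobiusFormula (i + length u) v
mobiusFormula-++ i []      v rewrite +-identityʳ i = sym (ℤ.*-identityˡ _)
mobiusFormula-++ i (a ∷ u) v rewrite +-suc i (length u) =
  trans (cong (atomSign i a *_) (mobiusFormula-++ (suc i) u v)) (sym (ℤ.*-assoc (atomSign i a) _ _))

mobiusFormula-ones : ∀ i n → mobiusFormula i (replicate n 1) ≡ 1ℤ
mobiusFormula-ones i zero    = refl
mobiusFormula-ones i (suc n) = trans (ℤ.*-identityˡ _) (mobiusFormula-ones (suc i) n)

mobiusFormula-▷ : ∀ i n {w} → All (1 ≤_) w → mobiusFormula (i + n) (n ▷ w) ≡ mobiusFormula i w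
mobiusFormula-▷ i n []                      = refl
mobiusFormula-▷ i n {suc zero ∷ w} (_ ∷ w≥1) = cong (1ℤ *_) (mobiusFormula-▷ (suc i) n w≥1)
mobiusFormula-▷ i n {a@(suc (suc _)) ∷ w} (_ ∷ w≥1) =
  cong₂ _*_ (trans (cong (atomSign (i + n)) (+-comm n a)) (atomSign-+ n {i} {a} (s≤s (s≤s z≤n))))
            (mobiusFormula-▷ (suc i) n w≥1)

idFrom : ℕ → ℕ → List ℕ
idFrom i zero    = []
idFrom i (suc m) = i ∷ idFrom (suc i) m

applyUpTo-idFrom : ∀ f i m → (∀ j → f j ≡ i + j) → applyUpTo f m ≡ idFrom i m
applyUpTo-idFrom f i zero    _ = refl
applyUpTo-idFrom f i (suc m) f≗ = cong₂ _∷_ (trans (f≗ 0) (+-identityʳ i))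
  (applyUpTo-idFrom (λ j → f (suc j)) (suc i) m (λ j → trans (f≗ (suc j)) (+-suc i j)))

idName≡idFrom : ∀ m → idName m ≡ idFrom 1 m
idName≡idFrom m = applyUpTo-idFrom suc 1 m (λ _ → refl)

mobiusFormula-+-idFrom : ∀ m {i n} → 1 ≤ i → 1 ≤ n →
  mobiusFormula (i + n) (map (_+ n) (idFrom i m)) ≡ -1ℤ ^ m
mobiusFormula-+-idFrom zero    _   _   = refl
mobiusFormula-+-idFrom (suc m) i≥1 n≥1 =
  cong₂ _*_ (atomSign-index (+-mono-≤ i≥1 n≥1)) (mobiusFormula-+-idFrom m (m≤n⇒m≤1+n i≥1) n≥1)

mobiusFormula-+-≢idFrom : ∀ {i n} w → 1 ≤ n → All (1 ≤_) w → w ≢ idFrom i (length w) →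
  mobiusFormula (i + n) (map (_+ n) w) ≡ 0ℤ
mobiusFormula-+-≢idFrom []      _   _          w≢id = ⊥-elim (w≢id refl)
mobiusFormula-+-≢idFrom {i} {n} (a ∷ w) n≥1 (a≥1 ∷ w≥1) w≢id with a ≟ i
... | yes refl = trans (cong (atomSign (a + n) (a + n) *_)
                              (mobiusFormula-+-≢idFrom w n≥1 w≥1 (λ w≡id → w≢id (cong (a ∷_) w≡id))))
                       (ℤ.*-zeroʳ (atomSign (a + n) (a + n)))
... | no a≢i   = cong (_* mobiusFormula (suc i + n) (map (_+ n) w))
                      (atomSign-other (>⇒≢ (+-mono-≤ a≥1 n≥1)) (a≢i ∘ +-cancelʳ-≡ n a i))

-- Names whose entries are 1 or their index

data OneOrIndex : ℕ → List ℕ → Set where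
  []  : ∀ {i} → OneOrIndex i []
  one : ∀ {i z} → OneOrIndex (suc i) z → OneOrIndex i (1 ∷ z)
  idx : ∀ {i z} → OneOrIndex (suc i) z → OneOrIndex i (i ∷ z)

onesOrIndices : ℕ → ℕ → List (List ℕ)
onesOrIndices i zero    = [ [] ]
onesOrIndices i (suc m) = map (1 ∷_) (onesOrIndices (suc i) m) ++ map (i ∷_) (onesOrIndices (suc i) m)

∈-onesOrIndices⁻ : ∀ i m {z} → z ∈ onesOrIndices i m → OneOrIndex i z × length z ≡ m
∈-onesOrIndices⁻ i zero    (here refl) = [] , refl
∈-onesOrIndices⁻ i (suc m) z∈ with ∈-++⁻ (map (1 ∷_) (onesOrIndices (suc i) m)) z∈
... | inj₁ z∈ones with ∈-map⁻ (1 ∷_) z∈ones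
...   | z , z∈ , refl with ∈-onesOrIndices⁻ (suc i) m z∈
...     | z∈oi , refl = one z∈oi , refl
∈-onesOrIndices⁻ i (suc m) z∈ | inj₂ z∈idx with ∈-map⁻ (i ∷_) z∈idx
...   | z , z∈ , refl with ∈-onesOrIndices⁻ (suc i) m z∈
...     | z∈oi , refl = idx z∈oi , refl

∈-onesOrIndices⁺ : ∀ {i z m} → OneOrIndex i z → length z ≡ m → z ∈ onesOrIndices i m
∈-onesOrIndices⁺ []      refl = here refl
∈-onesOrIndices⁺ (one h) refl = ∈-++⁺ˡ (∈-map⁺ (1 ∷_) (∈-onesOrIndices⁺ h refl))
∈-onesOrIndices⁺ {i} (idx {z = z} h) refl =
  ∈-++⁺ʳ (map (1 ∷_) (onesOrIndices (suc i) (length z))) (∈-map⁺ (i ∷_) (∈-onesOrIndices⁺ h refl))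

onesOrIndices-unique : ∀ {i} m → 2 ≤ i → Unique (onesOrIndices i m)
onesOrIndices-unique zero    _   = [] ∷ []
onesOrIndices-unique {i} (suc m) i≥2 =
  Unique.++⁺ (Unique.map⁺ ∷-injectiveʳ rest!) (Unique.map⁺ ∷-injectiveʳ rest!) disjoint
  where
  rest! = onesOrIndices-unique m (m≤n⇒m≤1+n i≥2)
  disjoint : ∀ {z} → ¬ (z ∈ map (1 ∷_) (onesOrIndices (suc i) m) × z ∈ map (i ∷_) (onesOrIndices (suc i) m))
  disjoint (z∈ones , z∈idx) with ∈-map⁻ (1 ∷_) z∈ones | ∈-map⁻ (i ∷_) z∈idx
  ... | _ , _ , refl | _ , _ , refl = >⇒≢ i≥2 refl

mobiusFormula-support : ∀ i z → mobiusFormula i z ≢ 0ℤ → OneOrIndex i z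
mobiusFormula-support i []      _  = []
mobiusFormula-support i (a ∷ z) f≢0
  with atomSign≢0 i a (f≢0 ∘ sign≡0) | mobiusFormula-support (suc i) z (f≢0 ∘ rest≡0)
  where
  sign≡0 : atomSign i a ≡ 0ℤ → mobiusFormula i (a ∷ z) ≡ 0ℤ
  sign≡0 e = cong (_* mobiusFormula (suc i) z) e
  rest≡0 : mobiusFormula (suc i) z ≡ 0ℤ → mobiusFormula i (a ∷ z) ≡ 0ℤ
  rest≡0 e = trans (cong (atomSign i a *_) e) (ℤ.*-zeroʳ (atomSign i a))
... | inj₁ refl | h = one h
... | inj₂ refl | h = idx h

NHat-length : ∀ {n v} → NHat n v → length v ≡ n
NHat-length (τ , refl , refl) = length-name τ

cherry-NHat : NHat 1 [ 1 ]
cherry-NHat = node leaf leaf , refl , refl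

NHat-∷ʳ : ∀ {n v a} → NHat n v → a ≡ 1 ⊎ a ≡ suc n → NHat (suc n) (v ++ [ a ])
NHat-∷ʳ {n} {v} hv (inj₁ refl) = subst (λ k → NHat k (v ++ [ 1 ])) (+-comm n 1) (↗-NHat hv cherry-NHat)
NHat-∷ʳ {n} {v} hv (inj₂ refl) =
  subst₂ NHat (+-comm n 1) (cong (λ l → v ++ [ suc l ]) (NHat-length hv)) (↖-NHat hv cherry-NHat)

NHat-++ : ∀ {n v z} → NHat n v → OneOrIndex (suc n) z → NHat (n + length z) (v ++ z)
NHat-++ {n} {v} hv [] = subst₂ NHat (sym (+-identityʳ n)) (sym (++-identityʳ v)) hv
NHat-++ {n} {v} hv (one {z = z} h) =
  subst₂ NHat (sym (+-suc n (length z))) (++-assoc v [ 1 ] z) (NHat-++ (NHat-∷ʳ hv (inj₁ refl)) h)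
NHat-++ {n} {v} hv (idx {z = z} h) =
  subst₂ NHat (sym (+-suc n (length z))) (++-assoc v [ suc n ] z) (NHat-++ (NHat-∷ʳ hv (inj₂ refl)) h)

data SomeEntry≥Index : ℕ → List ℕ → Set where
  here  : ∀ {i a y} → i ≤ a → SomeEntry≥Index i (a ∷ y)
  there : ∀ {i a y} → SomeEntry≥Index (suc i) y → SomeEntry≥Index i (a ∷ y)

SomeEntry≥Index-++ˡ : ∀ {i xs} ys → SomeEntry≥Index i xs → SomeEntry≥Index i (xs ++ ys)
SomeEntry≥Index-++ˡ ys (here i≤a)  = here i≤a
SomeEntry≥Index-++ˡ ys (there h)   = there (SomeEntry≥Index-++ˡ ys h)

SomeEntry≥Index-++ʳ : ∀ {i} xs {ys} → SomeEntry≥Index (i + length xs) ys → SomeEntry≥Index i (xs ++ ys)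
SomeEntry≥Index-++ʳ {i} []       {ys} h = subst (λ j → SomeEntry≥Index j ys) (+-identityʳ i) h
SomeEntry≥Index-++ʳ {i} (x ∷ xs) {ys} h =
  there (SomeEntry≥Index-++ʳ xs (subst (λ j → SomeEntry≥Index j ys) (+-suc i (length xs)) h))

sumℤ-below-∷ : ∀ i {c b y} → c ≤ b → ∀ A →
  sumℤ (map (mobiusFormula i) (filter (_≤ᶜ? (b ∷ y)) (map (c ∷_) A)))
    ≡ atomSign i c * sumℤ (map (mobiusFormula (suc i)) (filter (_≤ᶜ? y) A))
sumℤ-below-∷ i {c} {y = y} c≤b A = begin
    sumℤ (map (mobiusFormula i) (filter (_≤ᶜ? _) (map (c ∷_) A)))
  ≡⟨ cong (sumℤ ∘ map (mobiusFormula i)) (filter-≤ᶜ-∷-accept c≤b A) ⟩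
    sumℤ (map (mobiusFormula i) (map (c ∷_) (filter (_≤ᶜ? y) A)))
  ≡⟨ cong sumℤ (map-∘ (filter (_≤ᶜ? y) A)) ⟨
    sumℤ (map (λ z → atomSign i c * mobiusFormula (suc i) z) (filter (_≤ᶜ? y) A))
  ≡⟨ sumℤ-*ˡ (atomSign i c) (mobiusFormula (suc i)) (filter (_≤ᶜ? y) A) ⟩
    atomSign i c * sumℤ (map (mobiusFormula (suc i)) (filter (_≤ᶜ? y) A))
  ∎

-- Toggling an entry with y_j ≥ j between 1 and j is a sign-reversing involution on the terms.
sumℤ-below-onesOrIndices : ∀ {i} m {y} → 2 ≤ i → SomeEntry≥Index i y →
  sumℤ (map (mobiusFormula i) (filter (_≤ᶜ? y) (onesOrIndices i m))) ≡ 0ℤ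
sumℤ-below-onesOrIndices zero    _ (here _)  = refl
sumℤ-below-onesOrIndices zero    _ (there _) = refl
sumℤ-below-onesOrIndices {i} (suc m) {b ∷ y} i≥2 rise = begin
    sumℤ (map G (filter P (map (1 ∷_) A ++ map (i ∷_) A)))
  ≡⟨ cong (sumℤ ∘ map G) (filter-++ P (map (1 ∷_) A) (map (i ∷_) A)) ⟩
    sumℤ (map G (filter P (map (1 ∷_) A) ++ filter P (map (i ∷_) A)))
  ≡⟨ cong sumℤ (map-++ G (filter P (map (1 ∷_) A)) _) ⟩
    sumℤ (map G (filter P (map (1 ∷_) A)) ++ map G (filter P (map (i ∷_) A)))
  ≡⟨ sumℤ-++ (map G (filter P (map (1 ∷_) A))) _ ⟩
    sumℤ (map G (filter P (map (1 ∷_) A))) ℤ.+ sumℤ (map G (filter P (map (i ∷_) A)))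
  ≡⟨ pair rise ⟩
    0ℤ
  ∎
  where
  G = mobiusFormula i
  P = _≤ᶜ? (b ∷ y)
  A = onesOrIndices (suc i) m
  T = sumℤ (map (mobiusFormula (suc i)) (filter (_≤ᶜ? y) A))
  branch≡0 : ∀ c → T ≡ 0ℤ → sumℤ (map G (filter P (map (c ∷_) A))) ≡ 0ℤ
  branch≡0 c T≡0 with c ≤? b
  ... | yes c≤b =
    trans (sumℤ-below-∷ i c≤b A) (trans (cong (atomSign i c *_) T≡0) (ℤ.*-zeroʳ (atomSign i c)))
  ... | no c≰b  = cong (sumℤ ∘ map G) (filter-≤ᶜ-∷-reject c≰b A)
  pair : SomeEntry≥Index i (b ∷ y) →
    sumℤ (map G (filter P (map (1 ∷_) A))) ℤ.+ sumℤ (map G (filter P (map (i ∷_) A))) ≡ 0ℤ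
  pair (here i≤b) = begin
      sumℤ (map G (filter P (map (1 ∷_) A))) ℤ.+ sumℤ (map G (filter P (map (i ∷_) A)))
    ≡⟨ cong₂ ℤ._+_ (sumℤ-below-∷ i (≤-trans (≤-trans (s≤s z≤n) i≥2) i≤b) A)
                   (sumℤ-below-∷ i i≤b A) ⟩
      1ℤ * T ℤ.+ atomSign i i * T
    ≡⟨ cong (λ s → 1ℤ * T ℤ.+ s * T) (atomSign-index i≥2) ⟩
      1ℤ * T ℤ.+ -1ℤ * T
    ≡⟨ ℤ.*-distribʳ-+ T 1ℤ -1ℤ ⟨
      0ℤ * T
    ≡⟨⟩
      0ℤ
    ∎
  pair (there rise′) = cong₂ ℤ._+_ (branch≡0 1 T≡0) (branch≡0 i T≡0)
    where T≡0 = sumℤ-below-onesOrIndices m (m≤n⇒m≤1+n i≥2) rise′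

-- The Möbius function on names

nameFrom-node : ∀ k a b → ∃ λ r → nameFrom k (node a b) ≡ k ∷ r
nameFrom-node k leaf       b = _ , refl
nameFrom-node k (node c d) b with nameFrom-node k c d
... | r , e = _ , cong (_++ k ∷ nameFrom (k + leaves (node c d)) b) e

nameFrom-constant⊎rise : ∀ k t →
  nameFrom k t ≡ replicate (size t) k ⊎ ∃ λ y → nameFrom k t ≡ k ∷ y × SomeEntry≥Index (suc k) y
nameFrom-constant⊎rise k leaf       = inj₁ refl
nameFrom-constant⊎rise k (node a b) with nameFrom-constant⊎rise k a
... | inj₂ (y , e , rise) = inj₂ (_ , cong (_++ k ∷ nameFrom (k + leaves a) b) e , SomeEntry≥Index-++ˡ _ rise)
... | inj₁ e with b
...   | leaf = inj₁ (begin
          nameFrom k a ++ [ k ]              ≡⟨ cong (_++ [ k ]) e ⟩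
          replicate (size a) k ++ [ k ]      ≡⟨ replicate-∷ʳ (size a) k [] ⟩
          k ∷ replicate (size a) k ++ []     ≡⟨ cong (λ r → k ∷ r) (++-identityʳ _) ⟩
          k ∷ replicate (size a) k           ≡⟨ cong (λ n → k ∷ replicate n k) (+-identityʳ (size a)) ⟨
          replicate (size (node a leaf)) k   ∎)
...   | node c d with nameFrom-node (k + leaves a) c d
...     | r , e′ = inj₂ (replicate (size a) k ++ k + leaves a ∷ r , eq , rise)
  where
  eq : nameFrom k a ++ k ∷ nameFrom (k + leaves a) (node c d) ≡ k ∷ replicate (size a) k ++ k + leaves a ∷ r
  eq = trans (cong₂ (λ u v → u ++ k ∷ v) e e′) (replicate-∷ʳ (size a) k _)
  rise : SomeEntry≥Index (suc k) (replicate (size a) k ++ k + leaves a ∷ r)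
  rise = SomeEntry≥Index-++ʳ (replicate (size a) k) (here (≤-reflexive (begin
      suc k + length (replicate (size a) k)   ≡⟨ cong (suc k +_) (length-replicate (size a)) ⟩
      suc k + size a                          ≡⟨ +-suc k (size a) ⟨
      k + suc (size a)                        ≡⟨ cong (k +_) (leaves≡1+size a) ⟨
      k + leaves a                            ∎)))

NHat-ones⊎rise : ∀ {n v} → NHat n v → v ≡ replicate n 1 ⊎ ∃ λ y → v ≡ 1 ∷ y × SomeEntry≥Index 2 y
NHat-ones⊎rise (τ , refl , refl) rewrite name≡nameFrom τ = nameFrom-constant⊎rise 1 τ

treesOfHeight≤-complete : ∀ h τ → size τ ≤ h → τ ∈ treesOfHeight≤ h
treesOfHeight≤-complete zero    leaf       _          = here refl
treesOfHeight≤-complete (suc h) leaf       _          = here refl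
treesOfHeight≤-complete (suc h) (node a b) (s≤s size≤h) =
  there (∈-concatMap⁺ (λ a′ → map (node a′) (treesOfHeight≤ h)) (Any.map (λ { refl → ∈-map⁺ (node a) b∈ }) a∈))
  where
  a∈ = treesOfHeight≤-complete h a (≤-trans (m≤m+n (size a) (size b)) size≤h)
  b∈ = treesOfHeight≤-complete h b (≤-trans (m≤n+m (size b) (size a)) size≤h)

∈-elemsNHat⁺ : ∀ {n y} → NHat n y → y ∈ elemsNHat n
∈-elemsNHat⁺ (τ , refl , refl) = ∈-deduplicate⁺ (≡-dec ℕ._≟_)
  (∈-map⁺ name (∈-filter⁺ (λ t → size t ℕ.≟ size τ) (treesOfHeight≤-complete (size τ) τ ≤-refl) refl))

∈-elemsNHat⁻ : ∀ {n y} → y ∈ elemsNHat n → NHat n y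
∈-elemsNHat⁻ {n} y∈ with ∈-map⁻ name (∈-deduplicate⁻ (≡-dec ℕ._≟_) _ y∈)
... | τ , τ∈ , refl = τ , proj₂ (∈-filter⁻ (λ t → size t ℕ.≟ n) {xs = treesOfHeight≤ n} τ∈) , refl

elemsNHat-unique : ∀ n → Unique (elemsNHat n)
elemsNHat-unique n = deduplicate-! (map name (filter (λ τ → size τ ℕ.≟ n) (treesOfHeight≤ n)))

ones≤ᶜ : ∀ {v} → All (1 ≤_) v → replicate (length v) 1 ≤ᶜ v
ones≤ᶜ []           = []
ones≤ᶜ (a≥1 ∷ v≥1) = a≥1 ∷ ones≤ᶜ v≥1

NHat-ones≤ᶜ : ∀ {n v} → NHat n v → replicate n 1 ≤ᶜ v
NHat-ones≤ᶜ (τ , refl , refl) = subst (λ n → replicate n 1 ≤ᶜ name τ) (length-name τ) (ones≤ᶜ (name-≥1 τ))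

∈-onesOrIndices⇒NHat : ∀ m {z} → z ∈ map (1 ∷_) (onesOrIndices 2 m) → NHat (suc m) z
∈-onesOrIndices⇒NHat m z∈ with ∈-map⁻ (1 ∷_) z∈
... | z , z∈oi , refl with ∈-onesOrIndices⁻ 2 m z∈oi
...   | h , len = subst (λ l → NHat (suc l) (1 ∷ z)) len (NHat-++ cherry-NHat h)

mobiusFormula≢0⇒∈onesOrIndices : ∀ {m z} → NHat (suc m) z → mobiusFormula 1 z ≢ 0ℤ →
  z ∈ map (1 ∷_) (onesOrIndices 2 m)
mobiusFormula≢0⇒∈onesOrIndices {z = z} hz Gz≢0 with mobiusFormula-support 1 z Gz≢0 | NHat-length hz
... | one h | len = ∈-map⁺ (1 ∷_) (∈-onesOrIndices⁺ h (suc-injective len))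
... | idx h | len = ∈-map⁺ (1 ∷_) (∈-onesOrIndices⁺ h (suc-injective len))

sumℤ-interval-names : ∀ {n y} → y ∈ elemsNHat n → replicate n 1 ≢ y →
  sumℤ (map (mobiusFormula 1) (filter (Interval? (replicate n 1) y) (elemsNHat n))) ≡ 0ℤ
sumℤ-interval-names {n} y∈ ones≢y with NHat-ones⊎rise (∈-elemsNHat⁻ y∈)
... | inj₁ y≡ones = ⊥-elim (ones≢y (sym y≡ones))
... | inj₂ (y′ , refl , rise) = begin
    sumℤ (map G L)
  ≡⟨ sumℤ-support G L! K! K⊆L support ⟩
    sumℤ (map G K)
  ≡⟨ sumℤ-below-∷ 1 ≤-refl (onesOrIndices 2 m) ⟩
    1ℤ * sumℤ (map (mobiusFormula 2) (filter (_≤ᶜ? y′) (onesOrIndices 2 m)))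
  ≡⟨ cong (1ℤ *_) (sumℤ-below-onesOrIndices m ≤-refl rise) ⟩
    0ℤ
  ∎
  where
  m = length y′
  G = mobiusFormula 1
  Interval[1,y]? = Interval? (replicate n 1) (1 ∷ y′)
  L = filter Interval[1,y]? (elemsNHat n)
  K = filter (_≤ᶜ? (1 ∷ y′)) (map (1 ∷_) (onesOrIndices 2 m))
  1+m≡n : suc m ≡ n
  1+m≡n = NHat-length (∈-elemsNHat⁻ y∈)
  L! : Unique L
  L! = Unique.filter⁺ Interval[1,y]? (elemsNHat-unique n)
  K! : Unique K
  K! = Unique.filter⁺ (_≤ᶜ? (1 ∷ y′)) (Unique.map⁺ ∷-injectiveʳ (onesOrIndices-unique m ≤-refl))
  K⊆L : ∀ {z} → z ∈ K → z ∈ L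
  K⊆L z∈ with ∈-filter⁻ (_≤ᶜ? (1 ∷ y′)) {xs = map (1 ∷_) (onesOrIndices 2 m)} z∈
  ... | z∈′ , z≤y = ∈-filter⁺ Interval[1,y]? (∈-elemsNHat⁺ hz) (NHat-ones≤ᶜ hz , z≤y)
    where hz = subst (λ k → NHat k _) 1+m≡n (∈-onesOrIndices⇒NHat m z∈′)
  support : ∀ {z} → z ∈ L → G z ≢ 0ℤ → z ∈ K
  support z∈ Gz≢0 with ∈-filter⁻ Interval[1,y]? {xs = elemsNHat n} z∈
  ... | z∈els , _ , z≤y = ∈-filter⁺ (_≤ᶜ? (1 ∷ y′)) (mobiusFormula≢0⇒∈onesOrIndices hz Gz≢0) z≤y
    where hz = subst (λ k → NHat k _) (sym 1+m≡n) (∈-elemsNHat⁻ z∈els)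

M≡mobiusFormula : ∀ {n v} → NHat n v → M v ≡ mobiusFormula 1 v
M≡mobiusFormula hv@(τ , refl , refl) rewrite length-name τ =
  mobius-unique (elemsNHat (size τ)) (elemsNHat-unique (size τ)) (replicate (size τ) 1) (mobiusFormula 1)
    (mobiusFormula-ones 1 (size τ)) (λ y∈ _ → sumℤ-interval-names y∈) (∈-elemsNHat⁺ hv) (NHat-ones≤ᶜ hv)

NHat-≥1 : ∀ {n v} → NHat n v → All (1 ≤_) v
NHat-≥1 (τ , _ , refl) = name-≥1 τ

NHat-nonempty : ∀ {n v} → NHat n v → 1 ≤ n → 1 ≤ length v
NHat-nonempty hv n≥1 = subst (1 ≤_) (sym (NHat-length hv)) n≥1

M-↗ : ∀ {n m v w} → NHat n v → NHat m w → M (v ↗ w) ≡ M v * M w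
M-↗ {v = v} {w} hv hw = begin
    M (v ↗ w)
  ≡⟨ M≡mobiusFormula (↗-NHat hv hw) ⟩
    mobiusFormula 1 (v ↗ w)
  ≡⟨ mobiusFormula-++ 1 v _ ⟩
    mobiusFormula 1 v * mobiusFormula (1 + length v) (length v ▷ w)
  ≡⟨ cong (mobiusFormula 1 v *_) (mobiusFormula-▷ 1 (length v) (NHat-≥1 hw)) ⟩
    mobiusFormula 1 v * mobiusFormula 1 w
  ≡⟨ cong₂ _*_ (M≡mobiusFormula hv) (M≡mobiusFormula hw) ⟨
    M v * M w
  ∎

M-↖ : ∀ {n m v w} → NHat n v → NHat m w →
  M (v ↖ w) ≡ M v * mobiusFormula (1 + length v) (map (_+ length v) w)
M-↖ {v = v} {w} hv hw = begin
  M (v ↖ w)                ≡⟨ M≡mobiusFormula (↖-NHat hv hw) ⟩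
  mobiusFormula 1 (v ↖ w)  ≡⟨ mobiusFormula-++ 1 v _ ⟩
  mobiusFormula 1 v * G    ≡⟨ cong (_* G) (M≡mobiusFormula hv) ⟨
  M v * G                  ∎
  where G = mobiusFormula (1 + length v) (map (_+ length v) w)

M-↖-idName : ∀ {n m v} → 1 ≤ n → NHat n v → NHat m (idName m) → M (v ↖ idName m) ≡ -1ℤ ^ m * M v
M-↖-idName {m = m} {v} n≥1 hv hid = begin
    M (v ↖ idName m)
  ≡⟨ M-↖ hv hid ⟩
    M v * mobiusFormula (1 + length v) (map (_+ length v) (idName m))
  ≡⟨ cong (λ w → M v * mobiusFormula (1 + length v) (map (_+ length v) w)) (idName≡idFrom m) ⟩
    M v * mobiusFormula (1 + length v) (map (_+ length v) (idFrom 1 m))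
  ≡⟨ cong (M v *_) (mobiusFormula-+-idFrom m ≤-refl (NHat-nonempty hv n≥1)) ⟩
    M v * -1ℤ ^ m
  ≡⟨ ℤ.*-comm (M v) _ ⟩
    -1ℤ ^ m * M v
  ∎

M-↖-≢idName : ∀ {n m v w} → 1 ≤ n → NHat n v → NHat m w → w ≢ idName m → M (v ↖ w) ≡ 0ℤ
M-↖-≢idName {m = m} {v} {w} n≥1 hv hw w≢id = begin
    M (v ↖ w)
  ≡⟨ M-↖ hv hw ⟩
    M v * mobiusFormula (1 + length v) (map (_+ length v) w)
  ≡⟨ cong (M v *_) (mobiusFormula-+-≢idFrom w (NHat-nonempty hv n≥1) (NHat-≥1 hw) w≢idFrom) ⟩
    M v * 0ℤ
  ≡⟨ ℤ.*-zeroʳ (M v) ⟩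
    0ℤ
  ∎
  where
  w≢idFrom : w ≢ idFrom 1 (length w)
  w≢idFrom w≡ = w≢id (trans w≡ (trans (cong (idFrom 1) (NHat-length hw)) (sym (idName≡idFrom m))))

proposition3p3 :
    -- closure
    (∀ n m (v w : List ℕ) → 1 ≤ n → 1 ≤ m → NHat n v → NHat m w →
      NHat (n + m) (v ↗ w) × NHat (n + m) (v ↖ w))
    -- associative L-monoid axioms
    × (∀ n m k (u v w : List ℕ) → 1 ≤ n → 1 ≤ m → 1 ≤ k →
        NHat n u → NHat m v → NHat k w →
        ((u ↗ v) ↗ w ≡ u ↗ (v ↗ w))
        × ((u ↖ v) ↖ w ≡ u ↖ (v ↖ w))
        × ((u ↗ v) ↖ w ≡ u ↗ (v ↖ w)))
    -- name is a morphism of L-monoids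
    × (∀ (π τ : Tree) → 1 ≤ size π → 1 ≤ size τ →
        (name (π ↗ᵗ τ) ≡ name π ↗ name τ) × (name (π ↖ᵗ τ) ≡ name π ↖ name τ))
    -- Möbius function
    × (∀ n m (v w : List ℕ) → 1 ≤ n → 1 ≤ m → NHat n v → NHat m w →
        (M (v ↗ w) ≡ M v * M w)
        × (w ≡ idName m → M (v ↖ w) ≡ (-1ℤ ^ m) * M v)
        × (w ≢ idName m → M (v ↖ w) ≡ 0ℤ))
proposition3p3 =
  (λ _ _ _ _ _ _ hv hw → ↗-NHat hv hw , ↖-NHat hv hw) ,
  (λ _ _ _ u v _ _ m≥1 _ _ hv hw →
     ↗-assoc u v (NHat-≥1 hw) , ↖-assoc u v _ ,
     ↗-↖-assoc u v (NHat-nonempty hv m≥1) (NHat-≥1 hw)) ,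
  (λ π τ _ _ → name-↗ᵗ π τ , name-↖ᵗ π τ) ,
  (λ _ _ _ _ n≥1 _ hv hw →
     M-↗ hv hw ,
     (λ { refl → M-↖-idName n≥1 hv hw }) ,
     M-↖-≢idName n≥1 hv hw)
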